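{- Any two directed gashes in the same gash class have the same aura.
   Context: Labels are $0,\dots,7$ ($0,1,2$ simple); work in the plane tiled by unit equilateral triangles with a horizontal side. A triangular puzzle piece is a unit triangle whose labels, read counterclockwise, form a cyclic rotation of one of $(0,0,0),(1,1,1),(2,2,2),(3,0,1),(4,1,2),(5,0,2),(6,3,2),(7,0,4)$. Aura. Let $R=\mathbb{C}[\delta_0,\delta_1,\delta_2]$, viewing $\mathbb{C}$ as the plane. A semi-labeled edge is a unit edge with a label on one side. If the label $a$ is simple, its aura is $\mathcal{A}(e)=\delta_a v$ where $v\in\mathbb{C}$ is the unit vector perpendicular to $e$ pointing towards the side of the label. For composed labels the aura is determined by the rule that for every triangular puzzle piece, with its three side labels placed just inside the piece, the sum of the auras of the three semi-labeled sides is zero (this determines all auras consistently). The aura of a gash (an edge with a label on each side) is the sum of the auras of its two semi-labeled edges; the aura of a directed gash is that of the underlying gash. Gash classes. A directed gash is an edge with two labels and a direction perpendicular to it; the label on the side it points to is the original label, the other the new label; directed gashes are considered up to translation. $h$ is immediately reachable from $g$ if there are a unit triangle $\Delta$ with distinct sides $s,s'$ and triangular pieces $q,q'$ on $\Delta$ agreeing on the third side, with $g$ on $s$ pointing into $\Delta$ with original label $q(s)$ and new label $q'(s)$, and $h$ on $s'$ pointing out of $\Delta$ with original label $q(s')$ and new label $q'(s')$. The class $[g]$ is the set of directed gashes reachable from $g$ by finite chains of such steps. -}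

module Defs where

open import Data.Nat using (ℕ; _+_)
open import Data.Nat.DivMod using (_mod_)
open import Data.Integer as ℤ using (ℤ; +_; -_)
open import Data.Fin using (Fin; zero; suc; toℕ; _↑ˡ_)
open import Data.Product using (_×_; _,_)
open import Data.Sum using (_⊎_; inj₁; inj₂)
open import Relation.Binary.PropositionalEquality using (_≡_; refl; _≢_)

-- All unit normals of edges of the triangle grid are i·ζ^k (k = 0..5),
-- ζ = e^{iπ/3}.  They span the lattice i·ℤ[ζ] ⊂ ℂ; we represent its
-- elements by integer coordinates (a , b) meaning a·i + b·(i·ζ).
-- (This is an injective, additive encoding of a subgroup of ℂ.)

V : Set
V = ℤ × ℤ

_+V_ : V → V → V
(a , b) +V (c , d) = (a ℤ.+ c , b ℤ.+ d)

0V : V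
0V = (+ 0 , + 0)

-- directions: k : Fin 6 stands for the unit vector i·ζ^k
Dir : Set
Dir = Fin 6

-- rotation of a direction by n·60°
rot : Dir → ℕ → Dir
rot k n = (toℕ k + n) mod 6

-- the unit vector i·ζ^k, in coordinates (using ζ² = ζ - 1)
unit : Dir → V
unit zero                               = (+ 1 , + 0)
unit (suc zero)                         = (+ 0 , + 1)
unit (suc (suc zero))                   = (- (+ 1) , + 1)
unit (suc (suc (suc zero)))             = (- (+ 1) , + 0)
unit (suc (suc (suc (suc zero))))       = (+ 0 , - (+ 1))
unit (suc (suc (suc (suc (suc zero))))) = (+ 1 , - (+ 1))

-- Values of auras: elements δ₀ v₀ + δ₁ v₁ + δ₂ v₂ of ℂ[δ₀,δ₁,δ₂]
-- (homogeneous of degree one), recorded by the coefficients (v₀,v₁,v₂).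

M : Set
M = V × V × V

_+M_ : M → M → M
(a , b , c) +M (a' , b' , c') = (a +V a' , b +V b' , c +V c')

0M : M
0M = (0V , 0V , 0V)

δ· : Fin 3 → V → M
δ· zero             v = (v , 0V , 0V)
δ· (suc zero)       v = (0V , v , 0V)
δ· (suc (suc zero)) v = (0V , 0V , v)

Label : Set
Label = Fin 8

simple : Fin 3 → Label
simple a = a ↑ˡ 5

pattern L0 = zero
pattern L1 = suc zero
pattern L2 = suc (suc zero)
pattern L3 = suc (suc (suc zero))
pattern L4 = suc (suc (suc (suc zero)))
pattern L5 = suc (suc (suc (suc (suc zero))))
pattern L6 = suc (suc (suc (suc (suc (suc zero)))))
pattern L7 = suc (suc (suc (suc (suc (suc (suc zero))))))

data IsBase : Label → Label → Label → Set where
  b000 : IsBase L0 L0 L0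
  b111 : IsBase L1 L1 L1
  b222 : IsBase L2 L2 L2
  b301 : IsBase L3 L0 L1
  b412 : IsBase L4 L1 L2
  b502 : IsBase L5 L0 L2
  b632 : IsBase L6 L3 L2
  b704 : IsBase L7 L0 L4

IsPiece : Label → Label → Label → Set
IsPiece x y z = IsBase x y z ⊎ IsBase y z x ⊎ IsBase z x y

-- Unit triangles (up to translation): t = 0 has a horizontal side at the
-- bottom, t = 1 has a horizontal side at the top.  Sides j = 0,1,2 are
-- listed in counterclockwise order; side j of triangle t has inward unit
-- normal i·ζ^(t + 2j).

TriType : Set
TriType = Fin 2

inward : TriType → Fin 3 → Dir
inward t j = (toℕ t + 2 * toℕ j) mod 6
  where open import Data.Nat using (_*_)

outward : TriType → Fin 3 → Dir
outward t j = rot (inward t j) 3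

IsPieceOn : (Fin 3 → Label) → Set
IsPieceOn q = IsPiece (q zero) (q (suc zero)) (q (suc (suc zero)))

-- A semi-labeled edge (up to translation) is given by its label
-- a and the direction k of the unit normal pointing towards the label;
-- an aura assignment is a function A a k.

Aura : Set
Aura = Label → Dir → M

record IsAura (A : Aura) : Set where
  field
    simple-aura : ∀ (a : Fin 3) (k : Dir) → A (simple a) k ≡ δ· a (unit k)
    piece-rule  : ∀ (t : TriType) (x y z : Label) → IsPiece x y z →
                  (A x (inward t zero) +M A y (inward t (suc zero)))
                    +M A z (inward t (suc (suc zero))) ≡ 0M

-- Directed gashes (up to translation): direction k (the unit vector
-- perpendicular to the edge), original label (on the side k points to)
-- and new label (on the other side).

record Gash : Set where
  constructor mkGash
  field
    dir  : Dir
    orig : Label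
    new  : Label

gashAura : Aura → Gash → M
gashAura A (mkGash k o n) = A o k +M A n (rot k 3)

data Step : Gash → Gash → Set where
  step : ∀ {g h} (t : TriType) (s s' : Fin 3) (q q' : Fin 3 → Label) →
         s ≢ s' → IsPieceOn q → IsPieceOn q' →
         (∀ j → j ≢ s → j ≢ s' → q j ≡ q' j) →
         g ≡ mkGash (inward t s) (q s) (q' s) →
         h ≡ mkGash (outward t s') (q s') (q' s') →
         Step g h

open import Relation.Binary.Construct.Closure.ReflexiveTransitive using (Star)

Reachable : Gash → Gash → Set
Reachable = Star Step

InClass : Gash → Gash → Set
InClass g h = Reachable g h

-- Non-vacuity: an explicit aura assignment satisfying IsAura
-- (A a k = ζ^k · α_a).  Not used by the statement.

module Witness where
  open import Data.Nat using (zero; suc)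

  ζ·V : V → V                      -- multiplication by ζ (ζ² = ζ - 1)
  ζ·V (a , b) = (- b , a ℤ.+ b)

  ζ^ : ℕ → V → V
  ζ^ zero    v = v
  ζ^ (suc n) v = ζ·V (ζ^ n v)

  ζ^M : ℕ → M → M
  ζ^M n (a , b , c) = (ζ^ n a , ζ^ n b , ζ^ n c)

  i1 : V
  i1 = (+ 1 , + 0)

  α : Label → M
  α L0 = (i1 , 0V , 0V)
  α L1 = (0V , i1 , 0V)
  α L2 = (0V , 0V , i1)
  α L3 = (ζ^ 5 i1 , ζ^ 1 i1 , 0V)
  α L4 = (0V , ζ^ 5 i1 , ζ^ 1 i1)
  α L5 = (ζ^ 5 i1 , 0V , ζ^ 1 i1)
  α L6 = (ζ^ 4 i1 , i1 , ζ^ 1 i1)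
  α L7 = (ζ^ 5 i1 , i1 , ζ^ 2 i1)

  A₀ : Aura
  A₀ a k = ζ^M (toℕ k) (α a)

  base : ∀ t {x y z} → IsBase x y z →
         (A₀ x (inward t zero) +M A₀ y (inward t (suc zero)))
           +M A₀ z (inward t (suc (suc zero))) ≡ 0M
  base zero b000 = refl
  base zero b111 = refl
  base zero b222 = refl
  base zero b301 = refl
  base zero b412 = refl
  base zero b502 = refl
  base zero b632 = refl
  base zero b704 = refl
  base (suc zero) b000 = refl
  base (suc zero) b111 = refl
  base (suc zero) b222 = refl
  base (suc zero) b301 = refl
  base (suc zero) b412 = refl
  base (suc zero) b502 = refl
  base (suc zero) b632 = refl
  base (suc zero) b704 = refl

  rot1 : ∀ t {x y z} → IsBase x y z →
         (A₀ y (inward t zero) +M A₀ z (inward t (suc zero)))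
           +M A₀ x (inward t (suc (suc zero))) ≡ 0M
  rot1 zero b000 = refl
  rot1 zero b111 = refl
  rot1 zero b222 = refl
  rot1 zero b301 = refl
  rot1 zero b412 = refl
  rot1 zero b502 = refl
  rot1 zero b632 = refl
  rot1 zero b704 = refl
  rot1 (suc zero) b000 = refl
  rot1 (suc zero) b111 = refl
  rot1 (suc zero) b222 = refl
  rot1 (suc zero) b301 = refl
  rot1 (suc zero) b412 = refl
  rot1 (suc zero) b502 = refl
  rot1 (suc zero) b632 = refl
  rot1 (suc zero) b704 = refl

  rot2 : ∀ t {x y z} → IsBase x y z →
         (A₀ z (inward t zero) +M A₀ x (inward t (suc zero)))
           +M A₀ y (inward t (suc (suc zero))) ≡ 0M
  rot2 zero b000 = refl
  rot2 zero b111 = refl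
  rot2 zero b222 = refl
  rot2 zero b301 = refl
  rot2 zero b412 = refl
  rot2 zero b502 = refl
  rot2 zero b632 = refl
  rot2 zero b704 = refl
  rot2 (suc zero) b000 = refl
  rot2 (suc zero) b111 = refl
  rot2 (suc zero) b222 = refl
  rot2 (suc zero) b301 = refl
  rot2 (suc zero) b412 = refl
  rot2 (suc zero) b502 = refl
  rot2 (suc zero) b632 = refl
  rot2 (suc zero) b704 = refl

  simp : ∀ (a : Fin 3) (k : Dir) → A₀ (simple a) k ≡ δ· a (unit k)
  simp zero zero = refl
  simp zero (suc zero) = refl
  simp zero (suc (suc zero)) = refl
  simp zero (suc (suc (suc zero))) = refl
  simp zero (suc (suc (suc (suc zero)))) = refl
  simp zero (suc (suc (suc (suc (suc zero))))) = refl
  simp (suc zero) zero = refl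
  simp (suc zero) (suc zero) = refl
  simp (suc zero) (suc (suc zero)) = refl
  simp (suc zero) (suc (suc (suc zero))) = refl
  simp (suc zero) (suc (suc (suc (suc zero)))) = refl
  simp (suc zero) (suc (suc (suc (suc (suc zero))))) = refl
  simp (suc (suc zero)) zero = refl
  simp (suc (suc zero)) (suc zero) = refl
  simp (suc (suc zero)) (suc (suc zero)) = refl
  simp (suc (suc zero)) (suc (suc (suc zero))) = refl
  simp (suc (suc zero)) (suc (suc (suc (suc zero)))) = refl
  simp (suc (suc zero)) (suc (suc (suc (suc (suc zero))))) = refl

  isAura : IsAura A₀
  isAura = record
    { simple-aura = simp
    ; piece-rule  = λ { t x y z (inj₁ p) → base t p
                      ; t x y z (inj₂ (inj₁ p)) → rot2 t p
                      ; t x y z (inj₂ (inj₂ p)) → rot1 t p } }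

module Submission where

-- Both gashes are reachable from the generator of the class, so it suffices
-- that a single step g → h preserves the aura.  In such a step the pieces q
-- and q' on a triangle share the third side r, so the two piece rules
--   a_s + a_s' + a_r = 0   and   a'_s + a'_s' + a_r = 0
-- give  a_s − a'_s = −a_s' + a'_s'  for the auras a_j, a'_j of the sides.
-- The left side is the aura of g and the right side that of h, provided
-- every label is odd: its aura changes sign when the normal is reversed.
-- Oddness holds for simple labels by the explicit formula δ_a·v, and it
-- propagates from y, z to x along every basic piece (x, y, z), because the
-- piece rule holds for the piece in all six orientations and reversing all
-- three normals is again such an orientation.

open import Defs
open import Relation.Binary.PropositionalEquality
  using (_≡_; refl; cong; cong₂; _≢_; module ≡-Reasoning)
import Relation.Binary.PropositionalEquality as ≡
open import Algebra.Bundles using (AbelianGroup)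
open import Algebra.Structures using (IsAbelianGroup)
open import Level using (0ℓ)
open import Algebra.Construct.DirectProduct using (abelianGroup)
open import Data.Integer using (-_)
open import Data.Integer.Properties using (+-0-abelianGroup)
open import Data.Empty using (⊥-elim)
open import Data.Fin using (Fin; zero; suc; toℕ)
open import Data.Fin.Properties using (toℕ-injective; toℕ-fromℕ<; toℕ<n)
open import Data.Nat using (_+_; _%_)
open import Data.Nat.Properties using (+-assoc; +-comm)
open import Data.Nat.DivMod using (m%n<n; %-distribˡ-+; m%n%n≡m%n; [m+n]%n≡m%n; m<n⇒m%n≡m)
open import Data.Product using (_×_; _,_; uncurry)
open import Data.Sum using (inj₁; inj₂)
open import Relation.Binary.Construct.Closure.ReflexiveTransitive using (gfold)

rot-rot : ∀ k m n → rot (rot k m) n ≡ rot k (m + n)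
rot-rot k m n = toℕ-injective (begin
  toℕ (rot (rot k m) n)           ≡⟨ toℕ-fromℕ< (m%n<n (toℕ (rot k m) + n) 6) ⟩
  (toℕ (rot k m) + n) % 6         ≡⟨ cong (λ i → (i + n) % 6) (toℕ-fromℕ< (m%n<n (toℕ k + m) 6)) ⟩
  ((toℕ k + m) % 6 + n) % 6       ≡⟨ %-distribˡ-+ ((toℕ k + m) % 6) n 6 ⟩
  ((toℕ k + m) % 6 % 6 + n % 6) % 6 ≡⟨ cong (λ i → (i + n % 6) % 6) (m%n%n≡m%n (toℕ k + m) 6) ⟩
  ((toℕ k + m) % 6 + n % 6) % 6   ≡⟨ %-distribˡ-+ (toℕ k + m) n 6 ⟨
  (toℕ k + m + n) % 6             ≡⟨ cong (_% 6) (+-assoc (toℕ k) m n) ⟩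
  (toℕ k + (m + n)) % 6           ≡⟨ toℕ-fromℕ< (m%n<n (toℕ k + (m + n)) 6) ⟨
  toℕ (rot k (m + n))             ∎)
  where open ≡-Reasoning

rot-full-turn : ∀ k → rot k 6 ≡ k
rot-full-turn k = toℕ-injective (begin
  toℕ (rot k 6)    ≡⟨ toℕ-fromℕ< (m%n<n (toℕ k + 6) 6) ⟩
  (toℕ k + 6) % 6  ≡⟨ [m+n]%n≡m%n (toℕ k) 6 ⟩
  toℕ k % 6        ≡⟨ m<n⇒m%n≡m (toℕ<n k) ⟩
  toℕ k            ∎)
  where open ≡-Reasoning

rot-comm : ∀ k m n → rot (rot k m) n ≡ rot (rot k n) m
rot-comm k m n = ≡.trans (rot-rot k m n) (≡.trans (cong (rot k) (+-comm m n)) (≡.sym (rot-rot k n m)))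

opposite-opposite : ∀ k → rot (rot k 3) 3 ≡ k
opposite-opposite k = ≡.trans (rot-rot k 3 3) (rot-full-turn k)

-- The side of a triangle different from two given distinct sides
-- (the value on equal arguments is irrelevant).
third : Fin 3 → Fin 3 → Fin 3
third zero             (suc zero)       = suc (suc zero)
third (suc zero)       zero             = suc (suc zero)
third zero             (suc (suc zero)) = suc zero
third (suc (suc zero)) zero             = suc zero
third _                _                = zero

third-distinct : ∀ {s s'} → s ≢ s' → third s s' ≢ s × third s s' ≢ s'
third-distinct {zero}           {zero}           s≢s' = ⊥-elim (s≢s' refl)
third-distinct {zero}           {suc zero}       _    = (λ ()) , (λ ())
third-distinct {zero}           {suc (suc zero)} _    = (λ ()) , (λ ())
third-distinct {suc zero}       {zero}           _    = (λ ()) , (λ ())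
third-distinct {suc zero}       {suc zero}       s≢s' = ⊥-elim (s≢s' refl)
third-distinct {suc zero}       {suc (suc zero)} _    = (λ ()) , (λ ())
third-distinct {suc (suc zero)} {zero}           _    = (λ ()) , (λ ())
third-distinct {suc (suc zero)} {suc zero}       _    = (λ ()) , (λ ())
third-distinct {suc (suc zero)} {suc (suc zero)} s≢s' = ⊥-elim (s≢s' refl)

module TripleSums {c ℓ} (G : AbelianGroup c ℓ) where
  open AbelianGroup G renaming (refl to ≈-refl)
  open import Algebra.Properties.AbelianGroup G
    using (inverseˡ-unique; ⁻¹-∙-comm; ⁻¹-involutive)
  open import Algebra.Properties.CommutativeSemigroup commutativeSemigroup
    using (interchange; xy∙z≈xz∙y; xy∙z≈yx∙z; xy∙z≈yz∙x; xy∙z≈zx∙y; xy∙z≈zy∙x)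
  open import Relation.Binary.Reasoning.Setoid setoid

  Σ₃ : (Fin 3 → Carrier) → Carrier
  Σ₃ f = f zero ∙ f (suc zero) ∙ f (suc (suc zero))

  Σ₃-split : ∀ {s s'} → s ≢ s' → ∀ f → Σ₃ f ≈ f s ∙ f s' ∙ f (third s s')
  Σ₃-split {zero}           {zero}           s≢s' _ = ⊥-elim (s≢s' refl)
  Σ₃-split {zero}           {suc zero}       _    _ = ≈-refl
  Σ₃-split {zero}           {suc (suc zero)} _    _ = xy∙z≈xz∙y _ _ _
  Σ₃-split {suc zero}       {zero}           _    _ = xy∙z≈yx∙z _ _ _
  Σ₃-split {suc zero}       {suc zero}       s≢s' _ = ⊥-elim (s≢s' refl)
  Σ₃-split {suc zero}       {suc (suc zero)} _    _ = xy∙z≈yz∙x _ _ _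
  Σ₃-split {suc (suc zero)} {zero}           _    _ = xy∙z≈zx∙y _ _ _
  Σ₃-split {suc (suc zero)} {suc zero}       _    _ = xy∙z≈zy∙x _ _ _
  Σ₃-split {suc (suc zero)} {suc (suc zero)} s≢s' _ = ⊥-elim (s≢s' refl)

  rotate-sum : ∀ {x y z} → x ∙ y ∙ z ≈ ε → y ∙ z ∙ x ≈ ε
  rotate-sum {x} {y} {z} x+y+z≈0 = trans (sym (xy∙z≈yz∙x x y z)) x+y+z≈0

  solve-first : ∀ {x y z} → x ∙ y ∙ z ≈ ε → x ≈ (y ∙ z) ⁻¹
  solve-first {x} {y} {z} x+y+z≈0 = inverseˡ-unique x (y ∙ z) (trans (sym (assoc x y z)) x+y+z≈0)

  negated-triple : ∀ {x y z x'} → x ∙ y ∙ z ≈ ε → x' ∙ y ⁻¹ ∙ z ⁻¹ ≈ ε → x' ≈ x ⁻¹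
  negated-triple {x} {y} {z} {x'} sum≈0 sum'≈0 = begin
    x'                  ≈⟨ solve-first sum'≈0 ⟩
    (y ⁻¹ ∙ z ⁻¹) ⁻¹    ≈⟨ ⁻¹-cong (⁻¹-∙-comm y z) ⟩
    ((y ∙ z) ⁻¹) ⁻¹     ≈⟨ ⁻¹-cong (solve-first sum≈0) ⟨
    x ⁻¹                ∎

  exchange : ∀ {x y z x' y'} → x ∙ y ∙ z ≈ ε → x' ∙ y' ∙ z ≈ ε → x ∙ x' ⁻¹ ≈ y ⁻¹ ∙ y'
  exchange {x} {y} {z} {x'} {y'} sum≈0 sum'≈0 = begin
    x ∙ x' ⁻¹                        ≈⟨ ∙-cong (solve-first sum≈0) (⁻¹-cong (solve-first sum'≈0)) ⟩
    (y ∙ z) ⁻¹ ∙ ((y' ∙ z) ⁻¹) ⁻¹    ≈⟨ ∙-cong (sym (⁻¹-∙-comm y z)) (⁻¹-involutive (y' ∙ z)) ⟩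
    (y ⁻¹ ∙ z ⁻¹) ∙ (y' ∙ z)         ≈⟨ interchange (y ⁻¹) (z ⁻¹) y' z ⟩
    (y ⁻¹ ∙ y') ∙ (z ⁻¹ ∙ z)         ≈⟨ ∙-congˡ (inverseˡ z) ⟩
    (y ⁻¹ ∙ y') ∙ ε                  ≈⟨ identityʳ _ ⟩
    y ⁻¹ ∙ y'                        ∎

-V_ : V → V
-V (a , b) = (- a , - b)

unit-opposite : ∀ k → unit (rot k 3) ≡ -V unit k
unit-opposite zero                               = refl
unit-opposite (suc zero)                         = refl
unit-opposite (suc (suc zero))                   = refl
unit-opposite (suc (suc (suc zero)))             = refl
unit-opposite (suc (suc (suc (suc zero))))       = refl
unit-opposite (suc (suc (suc (suc (suc zero))))) = refl

-- Addition and negation are opaque, so that sums of auras are compared as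
-- formal sums instead of being unfolded into their integer components.
opaque
  infixl 6 _⊕_
  _⊕_ : M → M → M
  _⊕_ = _+M_

  ⊖_ : M → M
  ⊖ (u , v , w) = (-V u , -V v , -V w)

ℤ²-group ℤ⁶-group : AbelianGroup 0ℓ 0ℓ
ℤ²-group = abelianGroup +-0-abelianGroup +-0-abelianGroup
ℤ⁶-group = abelianGroup ℤ²-group (abelianGroup ℤ²-group ℤ²-group)

componentwise⇒≡ : ∀ {x y} → AbelianGroup._≈_ ℤ⁶-group x y → x ≡ y
componentwise⇒≡ ((refl , refl) , (refl , refl) , (refl , refl)) = refl

opaque
  unfolding _⊕_ ⊖_

  ⊕-isAbelianGroup : IsAbelianGroup _≡_ _⊕_ 0M ⊖_
  ⊕-isAbelianGroup = record
    { isGroup = record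
      { isMonoid = record
        { isSemigroup = record
          { isMagma = record { isEquivalence = ≡.isEquivalence ; ∙-cong = cong₂ _⊕_ }
          ; assoc   = λ x y z → componentwise⇒≡ (ℤ⁶.assoc x y z)
          }
        ; identity = (λ x → componentwise⇒≡ (ℤ⁶.identityˡ x))
                   , (λ x → componentwise⇒≡ (ℤ⁶.identityʳ x))
        }
      ; inverse = (λ x → componentwise⇒≡ (ℤ⁶.inverseˡ x))
                , (λ x → componentwise⇒≡ (ℤ⁶.inverseʳ x))
      ; ⁻¹-cong = cong ⊖_
      }
    ; comm = λ x y → componentwise⇒≡ (ℤ⁶.comm x y)
    }
    where module ℤ⁶ = AbelianGroup ℤ⁶-group

  ⊕-is-+M : ∀ x y → x ⊕ y ≡ x +M y
  ⊕-is-+M x y = refl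

  δ·-inverse : ∀ a v → δ· a (-V v) ≡ ⊖ δ· a v
  δ·-inverse zero             v = refl
  δ·-inverse (suc zero)       v = refl
  δ·-inverse (suc (suc zero)) v = refl

M-group : AbelianGroup 0ℓ 0ℓ
M-group = record { isAbelianGroup = ⊕-isAbelianGroup }

open TripleSums M-group

rotate-piece : ∀ {x y z} → IsPiece x y z → IsPiece z x y
rotate-piece (inj₁ b)        = inj₂ (inj₁ b)
rotate-piece (inj₂ (inj₁ b)) = inj₂ (inj₂ b)
rotate-piece (inj₂ (inj₂ b)) = inj₁ b

module _ (A : Aura) (isAura : IsAura A) where
  open IsAura isAura
  open ≡-Reasoning

  private
    t₀ t₁ : TriType
    t₀ = zero
    t₁ = suc zero

  piece-rule-⊕ : ∀ t {x y z} → IsPiece x y z →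
                 A x (inward t zero) ⊕ A y (inward t (suc zero)) ⊕ A z (inward t (suc (suc zero))) ≡ 0M
  piece-rule-⊕ t {x} {y} {z} p = begin
    a ⊕ b ⊕ c       ≡⟨ cong (_⊕ c) (⊕-is-+M a b) ⟩
    (a +M b) ⊕ c    ≡⟨ ⊕-is-+M (a +M b) c ⟩
    (a +M b) +M c   ≡⟨ piece-rule t x y z p ⟩
    0M              ∎
    where
    a b c : M
    a = A x (inward t zero)
    b = A y (inward t (suc zero))
    c = A z (inward t (suc (suc zero)))

  -- The piece rule for a piece whose first side has inward normal k, in
  -- any of the six orientations (the other sides then have normals k + 2
  -- and k + 4): put x on the first, second or third side of either triangle.
  piece-rule-any : ∀ {x y z} → IsPiece x y z → ∀ k →
                   A x k ⊕ A y (rot k 2) ⊕ A z (rot k 4) ≡ 0M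
  piece-rule-any p zero                               = piece-rule-⊕ t₀ p
  piece-rule-any p (suc zero)                         = piece-rule-⊕ t₁ p
  piece-rule-any p (suc (suc zero))                   = rotate-sum (piece-rule-⊕ t₀ (rotate-piece p))
  piece-rule-any p (suc (suc (suc zero)))             = rotate-sum (piece-rule-⊕ t₁ (rotate-piece p))
  piece-rule-any p (suc (suc (suc (suc zero))))       =
    rotate-sum (rotate-sum (piece-rule-⊕ t₀ (rotate-piece (rotate-piece p))))
  piece-rule-any p (suc (suc (suc (suc (suc zero))))) =
    rotate-sum (rotate-sum (piece-rule-⊕ t₁ (rotate-piece (rotate-piece p))))

  Odd : Label → Set
  Odd a = ∀ k → A a (rot k 3) ≡ ⊖ A a k

  simple-odd : ∀ a → Odd (simple a)
  simple-odd a k = begin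
    A (simple a) (rot k 3)   ≡⟨ simple-aura a (rot k 3) ⟩
    δ· a (unit (rot k 3))    ≡⟨ cong (δ· a) (unit-opposite k) ⟩
    δ· a (-V unit k)         ≡⟨ δ·-inverse a (unit k) ⟩
    ⊖ δ· a (unit k)          ≡⟨ cong ⊖_ (simple-aura a k) ⟨
    ⊖ A (simple a) k         ∎

  -- in a piece (x, y, z), x is odd as soon as y and z are: the piece rule
  -- with all normals reversed is the piece rule in the opposite orientation
  odd-from-piece : ∀ {x y z} → IsPiece x y z → Odd y → Odd z → Odd x
  odd-from-piece {x} {y} {z} p odd-y odd-z k =
    negated-triple (piece-rule-any p k) reversed
    where
    reversed : A x (rot k 3) ⊕ ⊖ A y (rot k 2) ⊕ ⊖ A z (rot k 4) ≡ 0M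
    reversed = begin
      A x (rot k 3) ⊕ ⊖ A y (rot k 2) ⊕ ⊖ A z (rot k 4)
        ≡⟨ cong₂ (λ u v → A x (rot k 3) ⊕ u ⊕ v) (odd-y (rot k 2)) (odd-z (rot k 4)) ⟨
      A x (rot k 3) ⊕ A y (rot (rot k 2) 3) ⊕ A z (rot (rot k 4) 3)
        ≡⟨ cong₂ (λ i j → A x (rot k 3) ⊕ A y i ⊕ A z j) (rot-comm k 2 3) (rot-comm k 4 3) ⟩
      A x (rot k 3) ⊕ A y (rot (rot k 3) 2) ⊕ A z (rot (rot k 3) 4)
        ≡⟨ piece-rule-any p (rot k 3) ⟩
      0M ∎

  odd₀ : Odd L0
  odd₁ : Odd L1
  odd₂ : Odd L2
  odd₃ : Odd L3
  odd₄ : Odd L4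
  odd₅ : Odd L5
  odd₆ : Odd L6
  odd₇ : Odd L7
  odd₀ = simple-odd zero
  odd₁ = simple-odd (suc zero)
  odd₂ = simple-odd (suc (suc zero))
  odd₃ = odd-from-piece (inj₁ b301) odd₀ odd₁
  odd₄ = odd-from-piece (inj₁ b412) odd₁ odd₂
  odd₅ = odd-from-piece (inj₁ b502) odd₀ odd₂
  odd₆ = odd-from-piece (inj₁ b632) odd₃ odd₂
  odd₇ = odd-from-piece (inj₁ b704) odd₀ odd₄

  odd : ∀ a → Odd a
  odd L0 = odd₀
  odd L1 = odd₁
  odd L2 = odd₂
  odd L3 = odd₃
  odd L4 = odd₄
  odd L5 = odd₅
  odd L6 = odd₆
  odd L7 = odd₇

  -- a single step preserves the aura: by oddness the aura of g is
  -- a_s − a'_s and that of h is −a_s' + a'_s', equal by the two piece rules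
  step-preserves-aura : ∀ {g h} → Step g h → gashAura A g ≡ gashAura A h
  step-preserves-aura (step t s s' q q' s≢s' piece piece' agree refl refl) = begin
    A (q s) (side s) +M A (q' s) (rot (side s) 3)
      ≡⟨ ⊕-is-+M _ _ ⟨
    a s ⊕ A (q' s) (rot (side s) 3)
      ≡⟨ cong (a s ⊕_) (odd (q' s) (side s)) ⟩
    a s ⊕ ⊖ a' s
      ≡⟨ exchange sum≡0 sum'≡0 ⟩
    ⊖ a s' ⊕ a' s'
      ≡⟨ cong₂ _⊕_ (odd (q s') (side s')) (cong (A (q' s')) (opposite-opposite (side s'))) ⟨
    A (q s') (rot (side s') 3) ⊕ A (q' s') (rot (rot (side s') 3) 3)
      ≡⟨ ⊕-is-+M _ _ ⟩
    A (q s') (rot (side s') 3) +M A (q' s') (rot (rot (side s') 3) 3) ∎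
    where
    side : Fin 3 → Dir
    side = inward t
    a a' : Fin 3 → M
    a  j = A (q j) (side j)
    a' j = A (q' j) (side j)
    r : Fin 3
    r = third s s'
    shared : a' r ≡ a r
    shared = cong (λ l → A l (side r)) (≡.sym (uncurry (agree r) (third-distinct s≢s')))
    sum≡0 : a s ⊕ a s' ⊕ a r ≡ 0M
    sum≡0 = ≡.trans (≡.sym (Σ₃-split s≢s' a)) (piece-rule-⊕ t piece)
    sum'≡0 : a' s ⊕ a' s' ⊕ a r ≡ 0M
    sum'≡0 = begin
      a' s ⊕ a' s' ⊕ a r   ≡⟨ cong (a' s ⊕ a' s' ⊕_) shared ⟨
      a' s ⊕ a' s' ⊕ a' r  ≡⟨ Σ₃-split s≢s' a' ⟨
      Σ₃ a'                ≡⟨ piece-rule-⊕ t piece' ⟩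
      0M                   ∎

  reachable-preserves-aura : ∀ {g h} → Reachable g h → gashAura A g ≡ gashAura A h
  reachable-preserves-aura =
    gfold (gashAura A) _≡_ (λ st eq → ≡.trans (step-preserves-aura st) eq) refl

lemma5p1 : (A : Aura) → IsAura A → (g₀ g h : Gash) →
           InClass g₀ g → InClass g₀ h → gashAura A g ≡ gashAura A h
lemma5p1 A isAura g₀ g h g₀⇝g g₀⇝h =
  ≡.trans (≡.sym (reachable-preserves-aura A isAura g₀⇝g)) (reachable-preserves-aura A isAura g₀⇝h)
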